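{- Let $\mathfrak A$ be a J-algebra and let $a,b\in A$ satisfy $a^{\smile};a\le1'$, $b^{\smile};b\le1'$ and $1=a^{\smile};b$. Then for all $x\in A$, $$(a^{\smile}\cdot b^{\smile});(a;x;a^{\smile}\cdot b;1';b^{\smile});a=x.$$
   Context: A J-algebra is an algebra $\langle A,\cdot,0,1,;,{}^{\smile},1'\rangle$ satisfying for all $x,y,z$: $x\cdot(y\cdot z)=(x\cdot y)\cdot z$, $x\cdot y=y\cdot x$, $x\cdot x=x$, $x;(y;z)=(x;y);z$, $x;1'=x$, $(x\cdot y);z=(x\cdot y);z\cdot y;z$, $x^{\smile\smile}=x$, $(x;y)^{\smile}=y^{\smile};x^{\smile}$, $(x\cdot y)^{\smile}=x^{\smile}\cdot y^{\smile}$, $x;y\cdot z=(z;y^{\smile}\cdot x);(y\cdot x^{\smile};z)\cdot z$, $0\cdot x=0$, $x\cdot1=x$, $x;0=0$. Converse binds tightest, then $;$, then $\cdot$. $x\le y$ means $x\cdot y=x$. -}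

module Defs where

open import Level using (Level; suc)
open import Relation.Binary.PropositionalEquality using (_≡_)

record JAlgebra (c : Level) : Set (suc c) where
  infixl 6 _·_
  infixl 7 _⨾_
  infix 8 _˘
  field
    A    : Set c
    _·_  : A → A → A
    𝟘    : A
    𝟙    : A
    _⨾_  : A → A → A
    _˘   : A → A
    1′   : A
    ·-assoc : ∀ x y z → x · (y · z) ≡ (x · y) · z
    ·-comm  : ∀ x y → x · y ≡ y · x
    ·-idem  : ∀ x → x · x ≡ x
    ⨾-assoc : ∀ x y z → x ⨾ (y ⨾ z) ≡ (x ⨾ y) ⨾ z
    ⨾-idʳ   : ∀ x → x ⨾ 1′ ≡ x
    ·-⨾-sub : ∀ x y z → (x · y) ⨾ z ≡ (x · y) ⨾ z · y ⨾ z
    ˘-invol : ∀ x → x ˘ ˘ ≡ x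
    ˘-⨾     : ∀ x y → (x ⨾ y) ˘ ≡ y ˘ ⨾ x ˘
    ˘-·     : ∀ x y → (x · y) ˘ ≡ x ˘ · y ˘
    modular : ∀ x y z → x ⨾ y · z ≡ (z ⨾ y ˘ · x) ⨾ (y · x ˘ ⨾ z) · z
    𝟘-·     : ∀ x → 𝟘 · x ≡ 𝟘
    ·-𝟙     : ∀ x → x · 𝟙 ≡ x
    ⨾-𝟘     : ∀ x → x ⨾ 𝟘 ≡ 𝟘

  infix 4 _≤_
  _≤_ : A → A → Set c
  x ≤ y = x · y ≡ x

module Submission where

open import Level using (Level)
open import Relation.Binary.Bundles using (Poset)
open import Relation.Binary.Structures using (IsPartialOrder)
open import Relation.Binary.PropositionalEquality
  using (_≡_; refl; sym; trans; cong; cong₂; subst; subst₂; isEquivalence; module ≡-Reasoning)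
open import Defs
import Relation.Binary.Reasoning.PartialOrder

-- Since 𝟙 = a ˘ ⨾ b, the modular law gives 1′ ≤ (a ˘ · b ˘) ⨾ (a · b), hence
-- x ≤ (a ˘ · b ˘) ⨾ ((a · b) ⨾ x).  Moreover (a · b) ⨾ x lies below
-- b ⨾ 𝟙 = b ⨾ b ˘ ⨾ a, and the modular law again pulls the trailing a out, bounding
-- it by ((a ⨾ x ⨾ a ˘) · (b ⨾ b ˘)) ⨾ a.  Conversely the left-hand side lies below
-- a ˘ ⨾ a ⨾ x ⨾ a ˘ ⨾ a ≤ x, since a ˘ ⨾ a ≤ 1′.

module JAlgebraProperties {c : Level} (𝔄 : JAlgebra c) where
  open JAlgebra 𝔄

  ≤-reflexive : ∀ {x y} → x ≡ y → x ≤ y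
  ≤-reflexive {x} refl = ·-idem x

  ≤-trans : ∀ {x y z} → x ≤ y → y ≤ z → x ≤ z
  ≤-trans {x} {y} {z} x≤y y≤z = begin
    x · z        ≡⟨ cong (_· z) (sym x≤y) ⟩
    x · y · z    ≡⟨ sym (·-assoc x y z) ⟩
    x · (y · z)  ≡⟨ cong (x ·_) y≤z ⟩
    x · y        ≡⟨ x≤y ⟩
    x            ∎
    where open ≡-Reasoning

  ≤-antisym : ∀ {x y} → x ≤ y → y ≤ x → x ≡ y
  ≤-antisym {x} {y} x≤y y≤x = trans (sym x≤y) (trans (·-comm x y) y≤x)

  ≤-isPartialOrder : IsPartialOrder _≡_ _≤_
  ≤-isPartialOrder = record
    { isPreorder = record
      { isEquivalence = isEquivalence
      ; reflexive     = ≤-reflexive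
      ; trans         = ≤-trans
      }
    ; antisym = ≤-antisym
    }

  ≤-poset : Poset c c c
  ≤-poset = record { isPartialOrder = ≤-isPartialOrder }

  module ≤-Reasoning = Relation.Binary.Reasoning.PartialOrder ≤-poset

  x·y≤x : ∀ x y → x · y ≤ x
  x·y≤x x y = begin
    x · y · x    ≡⟨ sym (·-assoc x y x) ⟩
    x · (y · x)  ≡⟨ cong (x ·_) (·-comm y x) ⟩
    x · (x · y)  ≡⟨ ·-assoc x x y ⟩
    x · x · y    ≡⟨ cong (_· y) (·-idem x) ⟩
    x · y        ∎
    where open ≡-Reasoning

  x·y≤y : ∀ x y → x · y ≤ y
  x·y≤y x y = trans (sym (·-assoc x y y)) (cong (x ·_) (·-idem y))

  ·-greatest : ∀ {x y z} → z ≤ x → z ≤ y → z ≤ x · y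
  ·-greatest {x} {y} {z} z≤x z≤y = trans (·-assoc z x y) (trans (cong (_· y) z≤x) z≤y)

  x≤𝟙 : ∀ x → x ≤ 𝟙
  x≤𝟙 = ·-𝟙

  ˘-mono-≤ : ∀ {x y} → x ≤ y → x ˘ ≤ y ˘
  ˘-mono-≤ {x} {y} x≤y = trans (sym (˘-· x y)) (cong _˘ x≤y)

  ˘-⨾-˘ : ∀ x y → (x ˘ ⨾ y ˘) ˘ ≡ y ⨾ x
  ˘-⨾-˘ x y = trans (˘-⨾ (x ˘) (y ˘)) (cong₂ _⨾_ (˘-invol y) (˘-invol x))

  1′˘≡1′ : 1′ ˘ ≡ 1′
  1′˘≡1′ = begin
    1′ ˘              ≡⟨ sym (⨾-idʳ (1′ ˘)) ⟩
    1′ ˘ ⨾ 1′         ≡⟨ cong (1′ ˘ ⨾_) (sym (˘-invol 1′)) ⟩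
    1′ ˘ ⨾ 1′ ˘ ˘     ≡⟨ sym (˘-⨾ (1′ ˘) 1′) ⟩
    (1′ ˘ ⨾ 1′) ˘     ≡⟨ cong _˘ (⨾-idʳ (1′ ˘)) ⟩
    1′ ˘ ˘            ≡⟨ ˘-invol 1′ ⟩
    1′                ∎
    where open ≡-Reasoning

  ⨾-idˡ : ∀ x → 1′ ⨾ x ≡ x
  ⨾-idˡ x = begin
    1′ ⨾ x          ≡⟨ cong (_⨾ x) (sym 1′˘≡1′) ⟩
    1′ ˘ ⨾ x        ≡⟨ cong (1′ ˘ ⨾_) (sym (˘-invol x)) ⟩
    1′ ˘ ⨾ x ˘ ˘    ≡⟨ sym (˘-⨾ (x ˘) 1′) ⟩
    (x ˘ ⨾ 1′) ˘    ≡⟨ cong _˘ (⨾-idʳ (x ˘)) ⟩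
    x ˘ ˘           ≡⟨ ˘-invol x ⟩
    x               ∎
    where open ≡-Reasoning

  𝟙˘≡𝟙 : 𝟙 ˘ ≡ 𝟙
  𝟙˘≡𝟙 = ≤-antisym (x≤𝟙 (𝟙 ˘)) (subst (_≤ 𝟙 ˘) (˘-invol 𝟙) (˘-mono-≤ (x≤𝟙 (𝟙 ˘))))

  ⨾-monoˡ-≤ : ∀ {x y} z → x ≤ y → x ⨾ z ≤ y ⨾ z
  ⨾-monoˡ-≤ {x} {y} z x≤y = subst (λ w → w ⨾ z · y ⨾ z ≡ w ⨾ z) x≤y (sym (·-⨾-sub x y z))

  ⨾-monoʳ-≤ : ∀ {x y} z → x ≤ y → z ⨾ x ≤ z ⨾ y
  ⨾-monoʳ-≤ {x} {y} z x≤y =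
    subst₂ _≤_ (˘-⨾-˘ x z) (˘-⨾-˘ y z) (˘-mono-≤ (⨾-monoˡ-≤ (z ˘) (˘-mono-≤ x≤y)))

  ⨾-mono-≤ : ∀ {w x y z} → w ≤ x → y ≤ z → w ⨾ y ≤ x ⨾ z
  ⨾-mono-≤ {x = x} {y} w≤x y≤z = ≤-trans (⨾-monoˡ-≤ y w≤x) (⨾-monoʳ-≤ x y≤z)

  modular-≤ : ∀ x y z → x ⨾ y · z ≤ (z ⨾ y ˘ · x) ⨾ (y · x ˘ ⨾ z)
  modular-≤ x y z = subst (_≤ (z ⨾ y ˘ · x) ⨾ (y · x ˘ ⨾ z)) (sym (modular x y z)) (x·y≤x _ z)

  dedekind-≤ : ∀ x y z → x ⨾ y · z ≤ (x · z ⨾ y ˘) ⨾ y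
  dedekind-≤ x y z = begin
    x ⨾ y · z                          ≤⟨ modular-≤ x y z ⟩
    (z ⨾ y ˘ · x) ⨾ (y · x ˘ ⨾ z)      ≤⟨ ⨾-mono-≤ (≤-reflexive (·-comm (z ⨾ y ˘) x)) (x·y≤x y _) ⟩
    (x · z ⨾ y ˘) ⨾ y                  ∎
    where open ≤-Reasoning

  a˘⨾b·1′≤[a˘·b˘]⨾[a·b] : ∀ a b → a ˘ ⨾ b · 1′ ≤ (a ˘ · b ˘) ⨾ (a · b)
  a˘⨾b·1′≤[a˘·b˘]⨾[a·b] a b = begin
    a ˘ ⨾ b · 1′                         ≤⟨ modular-≤ (a ˘) b 1′ ⟩
    (1′ ⨾ b ˘ · a ˘) ⨾ (b · a ˘ ˘ ⨾ 1′)   ≡⟨ cong₂ _⨾_ (cong (_· a ˘) (⨾-idˡ (b ˘)))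
                                                      (cong (b ·_) (trans (⨾-idʳ (a ˘ ˘)) (˘-invol a))) ⟩
    (b ˘ · a ˘) ⨾ (b · a)                ≡⟨ cong₂ _⨾_ (·-comm (b ˘) (a ˘)) (·-comm b a) ⟩
    (a ˘ · b ˘) ⨾ (a · b)                ∎
    where open ≤-Reasoning

  conjugate-≤ : ∀ {a} x → a ˘ ⨾ a ≤ 1′ → a ˘ ⨾ (a ⨾ x ⨾ a ˘) ⨾ a ≤ x
  conjugate-≤ {a} x a˘⨾a≤1′ = begin
    a ˘ ⨾ (a ⨾ x ⨾ a ˘) ⨾ a      ≡⟨ cong (_⨾ a) (trans (⨾-assoc (a ˘) (a ⨾ x) (a ˘))
                                                       (cong (_⨾ a ˘) (⨾-assoc (a ˘) a x))) ⟩
    a ˘ ⨾ a ⨾ x ⨾ a ˘ ⨾ a        ≡⟨ sym (⨾-assoc (a ˘ ⨾ a ⨾ x) (a ˘) a) ⟩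
    a ˘ ⨾ a ⨾ x ⨾ (a ˘ ⨾ a)      ≤⟨ ⨾-mono-≤ (⨾-monoˡ-≤ x a˘⨾a≤1′) a˘⨾a≤1′ ⟩
    1′ ⨾ x ⨾ 1′                  ≡⟨ trans (⨾-idʳ (1′ ⨾ x)) (⨾-idˡ x) ⟩
    x                            ∎
    where open ≤-Reasoning

  [a·b]⨾x≤[a⨾x⨾a˘·b⨾b˘]⨾a : ∀ {a b} x → 𝟙 ≡ b ˘ ⨾ a →
    (a · b) ⨾ x ≤ (a ⨾ x ⨾ a ˘ · b ⨾ b ˘) ⨾ a
  [a·b]⨾x≤[a⨾x⨾a˘·b⨾b˘]⨾a {a} {b} x 𝟙≡b˘⨾a = begin
    y                                ≤⟨ ·-greatest y≤b⨾b˘⨾a (≤-reflexive refl) ⟩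
    b ⨾ b ˘ ⨾ a · y                  ≤⟨ dedekind-≤ (b ⨾ b ˘) a y ⟩
    (b ⨾ b ˘ · y ⨾ a ˘) ⨾ a          ≤⟨ ⨾-monoˡ-≤ a (·-greatest
                                          (≤-trans (x·y≤y _ _) (⨾-monoˡ-≤ (a ˘) (⨾-monoˡ-≤ x (x·y≤x a b))))
                                          (x·y≤x _ _)) ⟩
    (a ⨾ x ⨾ a ˘ · b ⨾ b ˘) ⨾ a      ∎
    where
    open ≤-Reasoning
    y : A
    y = (a · b) ⨾ x
    y≤b⨾b˘⨾a : y ≤ b ⨾ b ˘ ⨾ a
    y≤b⨾b˘⨾a = begin
      y              ≤⟨ ⨾-mono-≤ (x·y≤y a b) (x≤𝟙 x) ⟩
      b ⨾ 𝟙          ≡⟨ cong (b ⨾_) 𝟙≡b˘⨾a ⟩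
      b ⨾ (b ˘ ⨾ a)  ≡⟨ ⨾-assoc b (b ˘) a ⟩
      b ⨾ b ˘ ⨾ a    ∎

proposition67 : ∀ {c : Level} (𝔄 : JAlgebra c) → let open JAlgebra 𝔄 in
    ∀ (a b : A) → a ˘ ⨾ a ≤ 1′ → b ˘ ⨾ b ≤ 1′ → 𝟙 ≡ a ˘ ⨾ b →
    ∀ (x : A) → (a ˘ · b ˘) ⨾ (a ⨾ x ⨾ a ˘ · b ⨾ 1′ ⨾ b ˘) ⨾ a ≡ x
proposition67 𝔄 a b a˘⨾a≤1′ _ 𝟙≡a˘⨾b x = ≤-antisym upper lower
  where
  open JAlgebra 𝔄
  open JAlgebraProperties 𝔄
  open ≤-Reasoning
  α = a ˘ · b ˘
  M = a ⨾ x ⨾ a ˘ · b ⨾ 1′ ⨾ b ˘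

  upper : α ⨾ M ⨾ a ≤ x
  upper = begin
    α ⨾ M ⨾ a                    ≤⟨ ⨾-monoˡ-≤ a (⨾-mono-≤ (x·y≤x (a ˘) (b ˘)) (x·y≤x _ _)) ⟩
    a ˘ ⨾ (a ⨾ x ⨾ a ˘) ⨾ a      ≤⟨ conjugate-≤ x a˘⨾a≤1′ ⟩
    x                            ∎

  1′≤α⨾[a·b] : 1′ ≤ α ⨾ (a · b)
  1′≤α⨾[a·b] = begin
    1′                 ≡⟨ trans (sym (·-𝟙 1′)) (·-comm 1′ 𝟙) ⟩
    𝟙 · 1′             ≡⟨ cong (_· 1′) 𝟙≡a˘⨾b ⟩
    a ˘ ⨾ b · 1′       ≤⟨ a˘⨾b·1′≤[a˘·b˘]⨾[a·b] a b ⟩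
    α ⨾ (a · b)        ∎

  𝟙≡b˘⨾a : 𝟙 ≡ b ˘ ⨾ a
  𝟙≡b˘⨾a = trans (sym 𝟙˘≡𝟙) (trans (cong _˘ 𝟙≡a˘⨾b)
             (trans (˘-⨾ (a ˘) b) (cong (b ˘ ⨾_) (˘-invol a))))

  lower : x ≤ α ⨾ M ⨾ a
  lower = begin
    x                                      ≡⟨ sym (⨾-idˡ x) ⟩
    1′ ⨾ x                                 ≤⟨ ⨾-monoˡ-≤ x 1′≤α⨾[a·b] ⟩
    α ⨾ (a · b) ⨾ x                        ≡⟨ sym (⨾-assoc α (a · b) x) ⟩
    α ⨾ ((a · b) ⨾ x)                      ≤⟨ ⨾-monoʳ-≤ α ([a·b]⨾x≤[a⨾x⨾a˘·b⨾b˘]⨾a x 𝟙≡b˘⨾a) ⟩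
    α ⨾ ((a ⨾ x ⨾ a ˘ · b ⨾ b ˘) ⨾ a)      ≡⟨ cong (λ w → α ⨾ ((a ⨾ x ⨾ a ˘ · w ⨾ b ˘) ⨾ a)) (sym (⨾-idʳ b)) ⟩
    α ⨾ (M ⨾ a)                            ≡⟨ ⨾-assoc α M a ⟩
    α ⨾ M ⨾ a                              ∎
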